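{- The class of languages of shape graphs coincides with the class of languages of shape expression schemas using only $\mathsf{RBE}_0$ type definitions: for every shape graph $H$ there is a shape expression schema $S$ all of whose type definitions are in $\mathsf{RBE}_0$ with $L(S)=L(H)$, and for every shape expression schema $S$ all of whose type definitions are in $\mathsf{RBE}_0$ there is a shape graph $H$ with $L(H)=L(S)$.
   Context: Fix a finite set $\Sigma$ of edge labels. An interval $[n;m]$ with $n\in\mathbb N$, $m\in\mathbb N\cup\{\infty\}$, $n\le m$, denotes $\{i\in\mathbb N: n\le i\le m\}$. Define $[n_1;m_1]\oplus[n_2;m_2]=[n_1+n_2;m_1+m_2]$, the empty $\oplus$-sum being $[0;0]$; $\subseteq$ between intervals is set inclusion. The basic intervals are $[1;1]$, $[0;1]$, $[1;\infty]$, $[0;\infty]$. A graph is a tuple $G=(N_G,E_G,\mathsf{source}_G,\mathsf{target}_G,\mathsf{lab}_G,\mathsf{occur}_G)$ with finite sets $N_G$ of nodes and $E_G$ of edges, $\mathsf{source}_G,\mathsf{target}_G:E_G\to N_G$, $\mathsf{lab}_G:E_G\to\Sigma$, and $\mathsf{occur}_G$ assigning an interval to each edge. Let $\mathsf{out}_G(n)=\{e\in E_G:\mathsf{source}_G(e)=n\}$. A graph is simple if every edge has interval $[1;1]$ and no two distinct edges have the same source, target and label. A shape graph is a graph using only basic intervals. For graphs $G,H$, a relation $R\subseteq N_G\times N_H$ is a simulation if for every $(n,m)\in R$ there is a function $\lambda:\mathsf{out}_G(n)\to\mathsf{out}_H(m)$ such that for every $e\in\mathsf{out}_G(n)$: $\mathsf{lab}_G(e)=\mathsf{lab}_H(\lambda(e))$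 and $(\mathsf{target}_G(e),\mathsf{target}_H(\lambda(e)))\in R$; and for every $f\in\mathsf{out}_H(m)$: $\bigoplus\{\mathsf{occur}_G(e): e\in\mathsf{out}_G(n),\lambda(e)=f\}\subseteq\mathsf{occur}_H(f)$. An embedding is a simulation $R$ whose domain is all of $N_G$; write $G\preccurlyeq H$ if one exists. $L(H)$ is the set of simple graphs $G$ with $G\preccurlyeq H$. Regular bag expressions (RBE) over a finite alphabet $\Delta$: $E::=\epsilon\mid a\mid (E\mid E)\mid (E\,\|\,E)\mid E^I$ with $a\in\Delta$, $I$ an interval; $L(\epsilon)=\{\text{empty bag}\}$, $L(a)=\{\{\!|a|\!\}\}$, $L(E_1\mid E_2)=L(E_1)\cup L(E_2)$, $L(E_1\|E_2)=\{w_1\uplus w_2: w_i\in L(E_i)\}$ (bag union), $L(E^I)=\bigcup_{i\in I}L(E)^i$ with $L^0$ the empty bag and $L^i=L\uplus L^{i-1}$. $\mathsf{RBE}_0$ is the class of expressions $a_1^{M_1}\|\cdots\|a_n^{M_n}$ with $a_i\in\Delta$ (not necessarily distinct) and $M_i$ basic intervals. A shape expression schema is $S=(\Gamma_S,\delta_S)$ with $\Gamma_S$ a finite set of types and $\delta_S$ mapping each type to an RBE over $\Sigma\times\Gamma_S$ (elements written $a::t$). For a simple graph $G$, a typing is $T\subseteq N_G\times\Gamma_S$; the signature of $n$ is the RBE $\|_{e\in\mathsf{out}_G(n)}\big(|_{t\in T(\mathsf{target}_G(e))}\mathsf{lab}_G(e)::t\big)$. $T$ is valid if $L(\mathrm{sign}^T(n))\cap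 L(\delta_S(t))\neq\emptyset$ for all $(n,t)\in T$. There is a unique maximal valid typing; $G$ satisfies $S$ if every node receives at least one type under it. $L(S)$ is the set of simple graphs satisfying $S$. -}

module Defs where

open import Data.Nat using (ℕ; zero; suc; _+_; _≤_; z≤n; s≤s)
open import Data.Nat.Properties using (+-mono-≤)
open import Data.Fin using (Fin)
open import Data.Fin.Properties using () renaming (_≟_ to _≟F_)
open import Data.List using (List; []; _∷_; _++_; map; foldr; filter)
open import Data.List.Relation.Binary.Permutation.Propositional using (_↭_)
open import Data.Product using (Σ; _×_; _,_; ∃)
open import Data.Sum using (_⊎_)
open import Data.Unit using (⊤; tt)
open import Data.Empty using (⊥)
open import Data.Bool using (Bool; true; false; if_then_else_)
open import Relation.Nullary using (Dec; yes; no; does)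
open import Relation.Binary.PropositionalEquality using (_≡_)
open import Data.List using (allFin) public

data ℕ∞ : Set where
  fin : ℕ → ℕ∞
  ∞   : ℕ∞

_≤∞_ : ℕ∞ → ℕ∞ → Set
fin a ≤∞ fin b = a ≤ b
fin a ≤∞ ∞     = ⊤
∞     ≤∞ fin b = ⊥
∞     ≤∞ ∞     = ⊤

_+∞_ : ℕ∞ → ℕ∞ → ℕ∞
fin a +∞ fin b = fin (a + b)
fin a +∞ ∞     = ∞
∞     +∞ _     = ∞

record Interval : Set where
  constructor ⟨_,_,_⟩
  field
    lo   : ℕ
    up   : ℕ∞
    lo≤up : fin lo ≤∞ up
open Interval public

_∈I_ : ℕ → Interval → Set
i ∈I I = (lo I ≤ i) × (fin i ≤∞ up I)

_⊆I_ : Interval → Interval → Set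
I ⊆I J = ∀ i → i ∈I I → i ∈I J

private
  ⊕-ok : ∀ a b (u v : ℕ∞) → fin a ≤∞ u → fin b ≤∞ v → fin (a + b) ≤∞ (u +∞ v)
  ⊕-ok a b (fin x) (fin y) p q = +-mono-≤ p q
  ⊕-ok a b (fin x) ∞ p q = tt
  ⊕-ok a b ∞ v p q = tt

_⊕_ : Interval → Interval → Interval
⟨ n₁ , m₁ , p ⟩ ⊕ ⟨ n₂ , m₂ , q ⟩ = ⟨ n₁ + n₂ , m₁ +∞ m₂ , ⊕-ok n₁ n₂ m₁ m₂ p q ⟩

zeroI : Interval
zeroI = ⟨ 0 , fin 0 , z≤n ⟩

data Basic : Set where
  b[1,1] b[0,1] b[1,∞] b[0,∞] : Basic

⟦_⟧ : Basic → Interval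
⟦ b[1,1] ⟧ = ⟨ 1 , fin 1 , s≤s z≤n ⟩
⟦ b[0,1] ⟧ = ⟨ 0 , fin 1 , z≤n ⟩
⟦ b[1,∞] ⟧ = ⟨ 1 , ∞ , tt ⟩
⟦ b[0,∞] ⟧ = ⟨ 0 , ∞ , tt ⟩

record Graph (k : ℕ) : Set where
  field
    nodes  : ℕ
    edges  : ℕ
    source : Fin edges → Fin nodes
    target : Fin edges → Fin nodes
    lab    : Fin edges → Fin k
    occur  : Fin edges → Interval
open Graph public

IsSimple : ∀ {k} → Graph k → Set
IsSimple G =
  (∀ e → occur G e ≡ ⟦ b[1,1] ⟧) ×
  (∀ e e' → source G e ≡ source G e' → target G e ≡ target G e' →
            lab G e ≡ lab G e' → e ≡ e')

IsShapeGraph : ∀ {k} → Graph k → Set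
IsShapeGraph G = ∀ e → Σ Basic λ b → occur G e ≡ ⟦ b ⟧

-- λ : out_G(n) → E_H (its values are required to lie in out_H(m) below)
Choice : ∀ {k} (G H : Graph k) → Fin (nodes G) → Set
Choice G H n = (e : Fin (edges G)) → source G e ≡ n → Fin (edges H)

-- ⊕{ occur_G(e) : e ∈ out_G(n), λ(e) = f }
sumOcc : ∀ {k} (G H : Graph k) (n : Fin (nodes G)) → Choice G H n →
         Fin (edges H) → Interval
sumOcc G H n lf f = foldr (λ e acc → contrib e (source G e ≟F n) ⊕ acc) zeroI (allFin (edges G))
  where
  contrib : (e : Fin (edges G)) → Dec (source G e ≡ n) → Interval
  contrib e (yes p) = if does (lf e p ≟F f) then occur G e else zeroI
  contrib e (no _)  = zeroI

IsSimulation : ∀ {k} (G H : Graph k) → (Fin (nodes G) → Fin (nodes H) → Set) → Set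
IsSimulation G H R =
  ∀ n m → R n m → Σ (Choice G H n) λ lf →
    (∀ e (p : source G e ≡ n) →
       (source H (lf e p) ≡ m) ×
       (lab G e ≡ lab H (lf e p)) ×
       R (target G e) (target H (lf e p))) ×
    (∀ f → source H f ≡ m → sumOcc G H n lf f ⊆I occur H f)

_≼_ : ∀ {k} → Graph k → Graph k → Set₁
G ≼ H = Σ (Fin (nodes G) → Fin (nodes H) → Set) λ R →
          IsSimulation G H R × (∀ n → Σ (Fin (nodes H)) λ m → R n m)

InLGraph : ∀ {k} → Graph k → Graph k → Set₁
InLGraph H G = IsSimple G × (G ≼ H)

-- Regular bag expressions; bags are lists up to permutation

data RBE (A : Set) : Set where
  ε    : RBE A
  sym  : A → RBE A
  _∣_  : RBE A → RBE A → RBE A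
  _∥_  : RBE A → RBE A → RBE A
  _^_  : RBE A → Interval → RBE A

Bag : Set → Set
Bag A = List A

Pow : ∀ {A : Set} → (Bag A → Set) → ℕ → Bag A → Set
Pow P zero    w = w ↭ []
Pow P (suc i) w = Σ _ λ w₁ → Σ _ λ w₂ → P w₁ × Pow P i w₂ × (w ↭ w₁ ++ w₂)

InL : ∀ {A : Set} → RBE A → Bag A → Set
InL ε         w = w ↭ []
InL (sym a)   w = w ↭ (a ∷ [])
InL (E₁ ∣ E₂) w = InL E₁ w ⊎ InL E₂ w
InL (E₁ ∥ E₂) w = Σ _ λ w₁ → Σ _ λ w₂ → InL E₁ w₁ × InL E₂ w₂ × (w ↭ w₁ ++ w₂)
InL (E ^ I)   w = Σ ℕ λ i → i ∈I I × Pow (InL E) i w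

rbe0 : ∀ {A : Set} → List (A × Basic) → RBE A
rbe0 []                 = ε
rbe0 ((a , M) ∷ [])     = sym a ^ ⟦ M ⟧
rbe0 ((a , M) ∷ x ∷ xs) = (sym a ^ ⟦ M ⟧) ∥ rbe0 (x ∷ xs)

IsRBE0 : ∀ {A : Set} → RBE A → Set
IsRBE0 {A} E = Σ (List (A × Basic)) λ xs → E ≡ rbe0 xs

record Schema (k : ℕ) : Set where
  field
    types : ℕ
    δ     : Fin types → RBE (Fin k × Fin types)
open Schema public

AllRBE0 : ∀ {k} → Schema k → Set
AllRBE0 S = ∀ t → IsRBE0 (δ S t)

-- typings T ⊆ N_G × Γ_S (as characteristic functions)
Typing : ∀ {k} → Graph k → Schema k → Set
Typing G S = Fin (nodes G) → Fin (types S) → Bool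

-- w ∈ L(sign^T(n)) where sign^T(n) = ∥_{e ∈ out(n)} ( |_{t ∈ T(target e)} lab(e)::t )
-- (an empty |-union denotes the empty language)
outList : ∀ {k} (G : Graph k) → Fin (nodes G) → List (Fin (edges G))
outList G n = filter (λ e → source G e ≟F n) (allFin (edges G))

InSign : ∀ {k} (G : Graph k) (S : Schema k) → Typing G S → Fin (nodes G) →
         Bag (Fin k × Fin (types S)) → Set
InSign G S T n w =
  Σ (Fin (edges G) → Fin (types S)) λ c →
    (∀ e → source G e ≡ n → T (target G e) (c e) ≡ true) ×
    (w ↭ map (λ e → lab G e , c e) (outList G n))

IsValid : ∀ {k} (G : Graph k) (S : Schema k) → Typing G S → Set
IsValid G S T = ∀ n t → T n t ≡ true →
  Σ _ λ w → InSign G S T n w × InL (δ S t) w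

Satisfies : ∀ {k} → Graph k → Schema k → Set
Satisfies G S = Σ (Typing G S) λ T →
  IsValid G S T ×
  (∀ T' → IsValid G S T' → ∀ n t → T' n t ≡ true → T n t ≡ true) ×
  (∀ n → Σ (Fin (types S)) λ t → T n t ≡ true)

InLSchema : ∀ {k} → Schema k → Graph k → Set
InLSchema S G = IsSimple G × Satisfies G S

-- A shape graph H is read as the schema S_H with one type per node m, defined by the RBE₀ expression
-- a₁::t₁^M₁ ∥ ⋯ ∥ aₙ::tₙ^Mₙ listing the out-edges of m; conversely an RBE₀ schema is read as the shape
-- graph with one edge per component, whose schema is the given one. So it suffices that L(S_H) = L(H).
-- For simple G, a simulation step at (n, m) and a typing witness of m at n are both equivalent to a
-- matching: a map from the out-edges of n to those of m respecting labels and the relation on targets,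
-- with fibre sizes in the intervals of H (a ⊕-sum of [1;1]'s is a fibre size, and a bag lies in
-- L(a₁^M₁ ∥ ⋯ ∥ aₙ^Mₙ) iff it is a permutation of a₁^r₁ ⋯ aₙ^rₙ with rᵢ ∈ Mᵢ). Matchings are monotone in
-- the relation and decidable, so pruning the full relation until it is stable yields the greatest
-- relation supported by matchings: it is the maximal valid typing, and it contains every simulation.

{-# OPTIONS --safe #-}
module Submission where

open import Defs
open import Data.Nat using (ℕ; zero; suc; _+_; _≤?_; _<_)
open import Data.Nat.Properties using (≤-refl; ≤-antisym)
open import Data.Nat.Induction using (<-wellFounded)
open import Data.Product using (Σ; ∃; _×_; _,_; proj₁; proj₂; uncurry)
open import Data.Product.Properties using () renaming (≡-dec to ×-≡-dec)
open import Data.Sum using (inj₁; inj₂)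
open import Data.Unit using (tt)
open import Data.Bool using (Bool; true; false; if_then_else_)
open import Data.Maybe using (Maybe; just; nothing; maybe′)
open import Data.Fin using (Fin)
open import Data.Fin.Properties using () renaming (_≟_ to _≟F_)
import Data.Fin.Properties as Fin
open import Data.Maybe.Properties using () renaming (≡-dec to Maybe-≡-dec)
import Data.List.Relation.Unary.Unique.Propositional.Properties as Unique
open import Axiom.UniquenessOfIdentityProofs using (module Decidable⇒UIP)
open import Data.List
  using (List; []; _∷_; _++_; map; foldr; filter; replicate; length; lookup; concatMap; cartesianProduct)
open import Data.List.Properties
  using ( ++-identityʳ; ++-conicalˡ; ++-conicalʳ; length-replicate; map-∘; map-id; map-tabulate; tabulate-lookup
        ; filter-notAll; filter-all; filter-none; filter-++)
open import Data.List.Membership.Propositional using (_∈_)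
open import Data.List.Membership.Propositional.Properties
  using (∈-filter⁺; ∈-filter⁻; ∈-allFin; ∈-cartesianProductWith⁺; ∈-++⁻)
import Data.List.Membership.DecPropositional as DecMembership
open import Data.List.Relation.Unary.Any using (here; there)
open import Data.List.Relation.Unary.All as All using (all?)
open import Data.List.Relation.Unary.All.Properties using (¬All⇒Any¬)
import Data.List.Relation.Unary.All.Properties as AllP
open import Data.List.Relation.Unary.AllPairs using (_∷_)
open import Data.List.Relation.Unary.Unique.Propositional using (Unique)
open import Data.List.Relation.Binary.Permutation.Propositional
  using (_↭_; ↭-refl; ↭-sym; ↭-trans; ↭-reflexive; prep)
open import Data.List.Relation.Binary.Permutation.Propositional.Properties
  using (++⁺; ++⁺ˡ; shift; drop-∷; ↭-empty-inv; ∈-resp-↭)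
open import Data.Vec as Vec using (Vec; []; _∷_)
open import Data.Vec.Properties using (lookup∘tabulate)
open import Function using (_∘_; _⇔_; mk⇔; Equivalence)
open import Induction.WellFounded using (Acc; acc)
open import Level using (0ℓ)
open import Relation.Binary using (REL; _⇒_; DecidableEquality) renaming (Decidable to Decidable₂)
open import Relation.Nullary using (Dec; yes; no; does; ¬_; contradiction)
open import Relation.Nullary.Decidable using (_×-dec_; _→-dec_; map′; dec-true; dec-false)
open import Relation.Unary using (Pred) renaming (Decidable to Decidable₁)
open import Relation.Binary.PropositionalEquality as ≡
  using (_≡_; _≢_; _≗_; refl; trans; cong; cong₂; subst; ≢-sym)
open import Function.Properties.Equivalence using () renaming (sym to ⇔-sym)

open ≡.≡-Reasoning

_≤∞?_ : (x y : ℕ∞) → Dec (x ≤∞ y)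
fin a ≤∞? fin b = a ≤? b
fin a ≤∞? ∞     = yes tt
∞     ≤∞? fin b = no λ ()
∞     ≤∞? ∞     = yes tt

_∈I?_ : (i : ℕ) (I : Interval) → Dec (i ∈I I)
i ∈I? I = (lo I ≤? i) ×-dec (fin i ≤∞? up I)

point-⊆I⇔∈I : ∀ {I J c} → lo I ≡ c → up I ≡ fin c → (I ⊆I J) ⇔ (c ∈I J)
point-⊆I⇔∈I {I} {J} {c} refl up≡c = mk⇔ (λ I⊆J → I⊆J c (≤-refl , c≤up)) c∈J⇒I⊆J
  where
  c≤up : fin c ≤∞ up I
  c≤up rewrite up≡c = ≤-refl
  c∈J⇒I⊆J : c ∈I J → I ⊆I J
  c∈J⇒I⊆J c∈J i (c≤i , i≤up) rewrite up≡c = subst (_∈I J) (≤-antisym c≤i i≤up) c∈J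

Exhaustible : Set → Set₁
Exhaustible A = ∀ {P : Pred A 0ℓ} → Decidable₁ P → Dec (∃ P)

Maybe-exhaustible : ∀ {A} → Exhaustible A → Exhaustible (Maybe A)
Maybe-exhaustible search P? with P? nothing | search (P? ∘ just)
... | yes p  | _           = yes (nothing , p)
... | no _   | yes (a , p) = yes (just a , p)
... | no ¬p₀ | no ¬p       = no λ { (nothing , p) → ¬p₀ p ; (just a , p) → ¬p (a , p) }

Vec-exhaustible : ∀ {A} → Exhaustible A → ∀ n → Exhaustible (Vec A n)
Vec-exhaustible search zero    P? = map′ (λ p → [] , p) (λ { ([] , p) → p }) (P? [])
Vec-exhaustible search (suc n) P? =
  map′ (λ (a , v , p) → a ∷ v , p) (λ { (a ∷ v , p) → a , v , p })
       (search λ a → Vec-exhaustible search n (P? ∘ (a ∷_)))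

Fin→-exhaustible : ∀ {A n} → Exhaustible A → {P : Pred (Fin n → A) 0ℓ} →
                   (∀ {f g} → f ≗ g → P f → P g) → Decidable₁ P → Dec (∃ P)
Fin→-exhaustible search resp P? =
  map′ (λ (v , p) → Vec.lookup v , p)
       (λ (f , p) → Vec.tabulate f , resp (≡.sym ∘ lookup∘tabulate f) p)
       (Vec-exhaustible search _ (P? ∘ Vec.lookup))

does-true⇒ : ∀ {X : Set} (x? : Dec X) → does x? ≡ true → X
does-true⇒ (yes x) _ = x

Holds : ∀ {A B : Set} → (A → B → Bool) → REL A B 0ℓ
Holds T a b = T a b ≡ true

module GreatestPostFixpoint {A B : ℕ}
  (P : REL (Fin A) (Fin B) 0ℓ → REL (Fin A) (Fin B) 0ℓ)
  (P-mono : ∀ {R R′} → R ⇒ R′ → P R ⇒ P R′)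
  (P? : ∀ {R} → Decidable₂ R → Decidable₂ (P R)) where

  open DecMembership (×-≡-dec (_≟F_ {A}) (_≟F_ {B})) using (_∈?_)

  Pairs : Set
  Pairs = List (Fin A × Fin B)

  Mem : Pairs → REL (Fin A) (Fin B) 0ℓ
  Mem ps a b = (a , b) ∈ ps

  mem? : ∀ ps → Decidable₂ (Mem ps)
  mem? ps a b = (a , b) ∈? ps

  PostFixed : REL (Fin A) (Fin B) 0ℓ → Set
  PostFixed R = R ⇒ P R

  GreatestPostFixedBelow : Pairs → Pairs → Set₁
  GreatestPostFixedBelow ps qs =
    PostFixed (Mem qs) × (∀ {Q} → PostFixed Q → Q ⇒ Mem ps → Q ⇒ Mem qs)

  Stable : Pairs → Set
  Stable ps = All.All (uncurry (P (Mem ps))) ps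

  prune : Pairs → Pairs
  prune ps = filter (uncurry (P? (mem? ps))) ps

  prune-shrinks : ∀ ps → ¬ Stable ps → length (prune ps) < length ps
  prune-shrinks ps unstable = filter-notAll _ ps (¬All⇒Any¬ (uncurry (P? (mem? ps))) ps unstable)

  prune-keeps : ∀ {Q} ps → PostFixed Q → Q ⇒ Mem ps → Q ⇒ Mem (prune ps)
  prune-keeps ps Q-post Q⊆ps q = ∈-filter⁺ _ (Q⊆ps q) (P-mono Q⊆ps (Q-post q))

  νBelow : ∀ ps → Acc _<_ (length ps) → Σ Pairs (GreatestPostFixedBelow ps)
  νBelow ps (acc smaller) with all? (uncurry (P? (mem? ps))) ps
  ... | yes stable  = ps , All.lookup stable , λ _ Q⊆ps → Q⊆ps
  ... | no unstable =
    let qs , qs-post , qs-greatest = νBelow (prune ps) (smaller (prune-shrinks ps unstable))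
    in  qs , qs-post , λ Q-post Q⊆ps → qs-greatest Q-post (prune-keeps ps Q-post Q⊆ps)

  allPairs : Pairs
  allPairs = cartesianProduct (allFin A) (allFin B)

  ∈-allPairs : ∀ a b → Mem allPairs a b
  ∈-allPairs a b = ∈-cartesianProductWith⁺ _,_ (∈-allFin a) (∈-allFin b)

  νPairs : Σ Pairs (GreatestPostFixedBelow allPairs)
  νPairs = νBelow allPairs (<-wellFounded (length allPairs))

  ν : Fin A → Fin B → Bool
  ν a b = does ((a , b) ∈? proj₁ νPairs)

  Mem⇒Holdsν : Mem (proj₁ νPairs) ⇒ Holds ν
  Mem⇒Holdsν {a} {b} = dec-true ((a , b) ∈? proj₁ νPairs)

  Holdsν⇒Mem : Holds ν ⇒ Mem (proj₁ νPairs)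
  Holdsν⇒Mem {a} {b} = does-true⇒ ((a , b) ∈? proj₁ νPairs)

  ν-post : PostFixed (Holds ν)
  ν-post νab = P-mono Mem⇒Holdsν (proj₁ (proj₂ νPairs) (Holdsν⇒Mem νab))

  ν-greatest : ∀ {Q} → PostFixed Q → Q ⇒ Holds ν
  ν-greatest Q-post q = Mem⇒Holdsν (proj₂ (proj₂ νPairs) Q-post (λ {a} {b} _ → ∈-allPairs a b) q)

module FunctionUpdate {X : Set} (_≟_ : DecidableEquality X) where

  _[_≔_] : ∀ {B : Set} → (X → B) → X → B → X → B
  (f [ x ≔ b ]) y = if does (y ≟ x) then b else f y

  update-≡ : ∀ {B} (f : X → B) x b → (f [ x ≔ b ]) x ≡ b
  update-≡ f x b rewrite dec-true (x ≟ x) refl = refl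

  update-≢ : ∀ {B} (f : X → B) {x y} b → y ≢ x → (f [ x ≔ b ]) y ≡ f y
  update-≢ f {x} {y} b y≢x rewrite dec-false (y ≟ x) y≢x = refl

Unique-head≢ : ∀ {X : Set} {x y : X} {xs} → Unique (x ∷ xs) → y ∈ xs → y ≢ x
Unique-head≢ (x≢xs ∷ _) y∈xs y≡x = All.lookup x≢xs y∈xs (≡.sym y≡x)

∈-replicate⁻ : ∀ {A : Set} {a b : A} n → b ∈ replicate n a → ∃ λ j → n ≡ suc j × a ≡ b
∈-replicate⁻ (suc n) (here b≡a) = n , refl , ≡.sym b≡a
∈-replicate⁻ (suc n) (there b∈) =
  let j , n≡ , a≡b = ∈-replicate⁻ n b∈ in suc j , cong suc n≡ , a≡b

Pow-resp-↭ : ∀ {A} {P : Bag A → Set} i {w w′} → w ↭ w′ → Pow P i w → Pow P i w′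
Pow-resp-↭ zero    w↭w′ w↭[]                      = ↭-trans (↭-sym w↭w′) w↭[]
Pow-resp-↭ (suc i) w↭w′ (w₁ , w₂ , p₁ , p₂ , w↭) = w₁ , w₂ , p₁ , p₂ , ↭-trans (↭-sym w↭w′) w↭

InL-resp-↭ : ∀ {A} (E : RBE A) {w w′} → w ↭ w′ → InL E w → InL E w′
InL-resp-↭ ε         w↭w′ w↭[]                      = ↭-trans (↭-sym w↭w′) w↭[]
InL-resp-↭ (sym a)   w↭w′ w↭a                       = ↭-trans (↭-sym w↭w′) w↭a
InL-resp-↭ (E₁ ∣ E₂) w↭w′ (inj₁ p)                  = inj₁ (InL-resp-↭ E₁ w↭w′ p)
InL-resp-↭ (E₁ ∣ E₂) w↭w′ (inj₂ p)                  = inj₂ (InL-resp-↭ E₂ w↭w′ p)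
InL-resp-↭ (E₁ ∥ E₂) w↭w′ (w₁ , w₂ , p₁ , p₂ , w↭) = w₁ , w₂ , p₁ , p₂ , ↭-trans (↭-sym w↭w′) w↭
InL-resp-↭ (E ^ I)   w↭w′ (i , i∈I , p)            = i , i∈I , Pow-resp-↭ i w↭w′ p

Pow-sym⇔replicate : ∀ {A} (a : A) i {w} → Pow (InL (sym a)) i w ⇔ (w ↭ replicate i a)
Pow-sym⇔replicate a i = mk⇔ (to i) (from i)
  where
  to : ∀ i {w} → Pow (InL (sym a)) i w → w ↭ replicate i a
  to zero    w↭[]                      = w↭[]
  to (suc i) (w₁ , w₂ , w₁↭a , p₂ , w↭) = ↭-trans w↭ (++⁺ w₁↭a (to i p₂))
  from : ∀ i {w} → w ↭ replicate i a → Pow (InL (sym a)) i w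
  from zero    w↭[] = w↭[]
  from (suc i) w↭   = a ∷ [] , replicate i a , ↭-refl , from i ↭-refl , w↭

-- rbe0 writes a one-component expression without a trailing ∥ ε.
InL-rbe0-∷ : ∀ {A} (a : A) M cs {w} →
             InL (rbe0 ((a , M) ∷ cs)) w ⇔ InL ((sym a ^ ⟦ M ⟧) ∥ rbe0 cs) w
InL-rbe0-∷ a M (c ∷ cs) = mk⇔ (λ p → p) (λ p → p)
InL-rbe0-∷ a M []   {w} =
  mk⇔ (λ p → w , [] , p , ↭-refl , ↭-reflexive (≡.sym (++-identityʳ w))) from
  where
  from : InL ((sym a ^ ⟦ M ⟧) ∥ ε) w → InL (sym a ^ ⟦ M ⟧) w
  from (w₁ , w₂ , p₁ , w₂↭[] , w↭) =
    InL-resp-↭ (sym a ^ ⟦ M ⟧)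
      (↭-sym (↭-trans w↭ (↭-trans (++⁺ˡ w₁ w₂↭[]) (↭-reflexive (++-identityʳ w₁))))) p₁

module Counting {Y : Set} (_≟_ : DecidableEquality Y) where

  hits : Maybe Y → Y → ℕ
  hits nothing   y = 0
  hits (just y′) y = if does (y′ ≟ y) then 1 else 0

  multiplicity : ∀ {X : Set} → (X → Maybe Y) → Y → List X → ℕ
  multiplicity α y []       = 0
  multiplicity α y (x ∷ xs) = hits (α x) y + multiplicity α y xs

  multiplicity-cong : ∀ {X : Set} {α α′ : X → Maybe Y} y xs → (∀ {x} → x ∈ xs → α x ≡ α′ x) →
                      multiplicity α y xs ≡ multiplicity α′ y xs
  multiplicity-cong y []       _    = refl
  multiplicity-cong y (x ∷ xs) α≡α′ =
    cong₂ _+_ (cong (λ m → hits m y) (α≡α′ (here refl))) (multiplicity-cong y xs (α≡α′ ∘ there))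

module Rbe₀Membership {X Y A : Set} (_≟X_ : DecidableEquality X) (_≟Y_ : DecidableEquality Y)
                (symbol : Y → A) (bound : Y → Basic) where

  module UX = FunctionUpdate _≟X_
  module UY = FunctionUpdate _≟Y_
  open Counting _≟Y_

  component : Y → A × Basic
  component y = symbol y , bound y

  blocks : (Y → ℕ) → List Y → List A
  blocks r []       = []
  blocks r (y ∷ ys) = replicate (r y) (symbol y) ++ blocks r ys

  Within : (Y → ℕ) → List Y → Set
  Within r ys = ∀ {y} → y ∈ ys → r y ∈I ⟦ bound y ⟧

  blocks-cong : ∀ {r r′} ys → (∀ {y} → y ∈ ys → r y ≡ r′ y) → blocks r ys ≡ blocks r′ ys
  blocks-cong []       r≡r′ = refl
  blocks-cong (y ∷ ys) r≡r′ =
    cong₂ (λ n → replicate n (symbol y) ++_) (r≡r′ (here refl)) (blocks-cong ys (r≡r′ ∘ there))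

  blocks-zero : ∀ ys → blocks (λ _ → 0) ys ≡ []
  blocks-zero []       = refl
  blocks-zero (y ∷ ys) = blocks-zero ys

  blocks≡[] : ∀ {r} ys → blocks r ys ≡ [] → ∀ {y} → y ∈ ys → r y ≡ 0
  blocks≡[] {r} (y ∷ ys) eq (here refl) =
    trans (≡.sym (length-replicate (r y))) (cong length (++-conicalˡ (replicate (r y) (symbol y)) _ eq))
  blocks≡[] {r} (y ∷ ys) eq (there y∈) = blocks≡[] ys (++-conicalʳ (replicate (r y) (symbol y)) _ eq) y∈

  ∈-blocks : ∀ {r a} ys → a ∈ blocks r ys → ∃ λ y → y ∈ ys × (∃ λ j → r y ≡ suc j) × symbol y ≡ a
  ∈-blocks {r} (y ∷ ys) a∈ with ∈-++⁻ (replicate (r y) (symbol y)) a∈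
  ... | inj₁ a∈rep = let j , r≡ , sy≡a = ∈-replicate⁻ (r y) a∈rep in y , here refl , (j , r≡) , sy≡a
  ... | inj₂ a∈ys  = let y′ , y′∈ , r≡ , sy≡a = ∈-blocks ys a∈ys in y′ , there y′∈ , r≡ , sy≡a

  blocks-suc : ∀ {r r′ y₀} ys → Unique ys → y₀ ∈ ys → r y₀ ≡ suc (r′ y₀) →
               (∀ {y} → y ∈ ys → y ≢ y₀ → r y ≡ r′ y) → blocks r ys ↭ symbol y₀ ∷ blocks r′ ys
  blocks-suc {r} {r′} (y ∷ ys) u (here refl) r≡ r≡r′ rewrite r≡ =
    prep (symbol y) (++⁺ˡ (replicate (r′ y) (symbol y))
      (↭-reflexive (blocks-cong ys λ y′∈ → r≡r′ (there y′∈) (Unique-head≢ u y′∈))))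
  blocks-suc {r} {r′} {y₀} (y ∷ ys) u@(_ ∷ u′) (there y₀∈) r≡ r≡r′
    rewrite r≡r′ (here refl) (≢-sym (Unique-head≢ u y₀∈)) =
    ↭-trans (++⁺ˡ (replicate (r′ y) (symbol y)) (blocks-suc ys u′ y₀∈ r≡ (r≡r′ ∘ there)))
            (shift (symbol y₀) (replicate (r′ y) (symbol y)) (blocks r′ ys))

  blocks-∈rbe0 : ∀ {r} ys → Within r ys → InL (rbe0 (map component ys)) (blocks r ys)
  blocks-∈rbe0     []       _        = ↭-refl
  blocks-∈rbe0 {r} (y ∷ ys) r-within =
    Equivalence.from (InL-rbe0-∷ (symbol y) (bound y) (map component ys))
      ( replicate (r y) (symbol y) , blocks r ys
      , (r y , r-within (here refl) , Equivalence.from (Pow-sym⇔replicate (symbol y) (r y)) ↭-refl)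
      , blocks-∈rbe0 ys (r-within ∘ there) , ↭-refl)

  ∈rbe0⇒blocks : ∀ {w} ys → Unique ys → InL (rbe0 (map component ys)) w →
                 ∃ λ r → Within r ys × w ↭ blocks r ys
  ∈rbe0⇒blocks []       _ w↭[] = (λ _ → 0) , (λ ()) , w↭[]
  ∈rbe0⇒blocks (y ∷ ys) u@(_ ∷ u′) p
    with w₁ , w₂ , (i , i∈M , pw₁) , p₂ , w↭
           ← Equivalence.to (InL-rbe0-∷ (symbol y) (bound y) (map component ys)) p
    with r , r-within , w₂↭ ← ∈rbe0⇒blocks ys u′ p₂ =
    r UY.[ y ≔ i ] , within ,
    ↭-trans w↭ (↭-trans (++⁺ (Equivalence.to (Pow-sym⇔replicate (symbol y) i) pw₁) w₂↭)
      (↭-reflexive (cong₂ (λ n → replicate n (symbol y) ++_)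
                          (≡.sym (UY.update-≡ r y i)) (≡.sym (blocks-cong ys unchanged)))))
    where
    unchanged : ∀ {y′} → y′ ∈ ys → (r UY.[ y ≔ i ]) y′ ≡ r y′
    unchanged y′∈ = UY.update-≢ r i (Unique-head≢ u y′∈)
    within : Within (r UY.[ y ≔ i ]) (y ∷ ys)
    within (here refl) rewrite UY.update-≡ r y i = i∈M
    within (there y′∈) rewrite unchanged y′∈ = r-within y′∈

  AssignedIn : (X → Maybe Y) → (X → A) → List Y → X → Set
  AssignedIn α label ys x = ∃ λ y → α x ≡ just y × y ∈ ys × symbol y ≡ label x

  Assignment : (X → Maybe Y) → (X → A) → List X → List Y → Set
  Assignment α label xs ys = ∀ {x} → x ∈ xs → AssignedIn α label ys x

  blocks⇒assignment : ∀ {label r ys} xs → Unique xs → Unique ys → map label xs ↭ blocks r ys →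
    ∃ λ α → Assignment α label xs ys × (∀ {y} → y ∈ ys → multiplicity α y xs ≡ r y)
  blocks⇒assignment {ys = ys} [] _ _ []↭ =
    (λ _ → nothing) , (λ ()) , λ y∈ → ≡.sym (blocks≡[] ys (↭-empty-inv (↭-sym []↭)) y∈)
  blocks⇒assignment {label} {r} {ys} (x ∷ xs) ux@(_ ∷ ux′) uy p
    with y₀ , y₀∈ , (j , r≡) , sy₀≡ ← ∈-blocks ys (∈-resp-↭ p (here refl)) = α , assigned , counted
    where
    r′ : Y → ℕ
    r′ = r UY.[ y₀ ≔ j ]
    p′ : map label xs ↭ blocks r′ ys
    p′ = drop-∷ (↭-trans p (subst (λ a → blocks r ys ↭ a ∷ blocks r′ ys) sy₀≡
           (blocks-suc ys uy y₀∈ (trans r≡ (cong suc (≡.sym (UY.update-≡ r y₀ j))))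
                       (λ _ y≢y₀ → ≡.sym (UY.update-≢ r j y≢y₀)))))
    IH : ∃ λ α′ → Assignment α′ label xs ys × (∀ {y} → y ∈ ys → multiplicity α′ y xs ≡ r′ y)
    IH = blocks⇒assignment xs ux′ uy p′
    α′ : X → Maybe Y
    α′ = proj₁ IH
    α : X → Maybe Y
    α = α′ UX.[ x ≔ just y₀ ]
    α≡α′ : ∀ {x′} → x′ ∈ xs → α x′ ≡ α′ x′
    α≡α′ x′∈ = UX.update-≢ α′ (just y₀) (Unique-head≢ ux x′∈)
    assigned : Assignment α label (x ∷ xs) ys
    assigned (here refl) = y₀ , UX.update-≡ α′ x (just y₀) , y₀∈ , sy₀≡
    assigned (there x′∈) =
      let y , α′x′≡ , y∈ , sy≡ = proj₁ (proj₂ IH) x′∈ in y , trans (α≡α′ x′∈) α′x′≡ , y∈ , sy≡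
    counted : ∀ {y} → y ∈ ys → multiplicity α y (x ∷ xs) ≡ r y
    counted {y} y∈ rewrite UX.update-≡ α′ x (just y₀) | multiplicity-cong y xs α≡α′ | proj₂ (proj₂ IH) y∈
      with y₀ ≟Y y
    ... | yes refl  = trans (cong suc (UY.update-≡ r y₀ j)) (≡.sym r≡)
    ... | no  y₀≢y = UY.update-≢ r j (≢-sym y₀≢y)

  assignment⇒blocks : ∀ {α label ys} xs → Unique ys → Assignment α label xs ys →
                      map label xs ↭ blocks (λ y → multiplicity α y xs) ys
  assignment⇒blocks {ys = ys} [] _ _ = ↭-reflexive (≡.sym (blocks-zero ys))
  assignment⇒blocks {α} {label} {ys} (x ∷ xs) uy assigned
    with y₀ , αx≡ , y₀∈ , sy₀≡ ← assigned (here refl) =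
    ↭-trans (prep (label x) (assignment⇒blocks xs uy (assigned ∘ there)))
      (↭-sym (subst (λ a → blocks (λ y → multiplicity α y (x ∷ xs)) ys ↭ a ∷ blocks (λ y → multiplicity α y xs) ys)
                    sy₀≡ (blocks-suc ys uy y₀∈ one-more unchanged)))
    where
    one-more : multiplicity α y₀ (x ∷ xs) ≡ suc (multiplicity α y₀ xs)
    one-more rewrite αx≡ | dec-true (y₀ ≟Y y₀) refl = refl
    unchanged : ∀ {y} → y ∈ ys → y ≢ y₀ → multiplicity α y (x ∷ xs) ≡ multiplicity α y xs
    unchanged {y} _ y≢y₀ rewrite αx≡ | dec-false (y₀ ≟Y y) (≢-sym y≢y₀) = refl

  Rbe₀Assignment : (X → Maybe Y) → (X → A) → List X → List Y → Set
  Rbe₀Assignment α label xs ys = Assignment α label xs ys × Within (λ y → multiplicity α y xs) ys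

  ∈rbe0⇒assignment : ∀ {label xs ys} → Unique xs → Unique ys → InL (rbe0 (map component ys)) (map label xs) →
                     ∃ λ α → Rbe₀Assignment α label xs ys
  ∈rbe0⇒assignment {xs = xs} {ys} ux uy p
    with r , r-within , ↭blocks ← ∈rbe0⇒blocks ys uy p
    with α , assigned , counts  ← blocks⇒assignment xs ux uy ↭blocks =
    α , assigned , λ {y} y∈ → subst (_∈I ⟦ bound y ⟧) (≡.sym (counts y∈)) (r-within y∈)

  assignment⇒∈rbe0 : ∀ {α label xs ys} → Unique ys → Rbe₀Assignment α label xs ys →
                     InL (rbe0 (map component ys)) (map label xs)
  assignment⇒∈rbe0 {xs = xs} {ys} uy (assigned , within) =
    InL-resp-↭ (rbe0 (map component ys)) (↭-sym (assignment⇒blocks xs uy assigned))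
      (blocks-∈rbe0 ys within)

module _ {k : ℕ} (G : Graph k) where

  ∈-outList⁺ : ∀ {n e} → source G e ≡ n → e ∈ outList G n
  ∈-outList⁺ {n} {e} = ∈-filter⁺ (λ e → source G e ≟F n) (∈-allFin e)

  ∈-outList⁻ : ∀ {n e} → e ∈ outList G n → source G e ≡ n
  ∈-outList⁻ {n} = proj₂ ∘ ∈-filter⁻ (λ e → source G e ≟F n) {xs = allFin (edges G)}

  outList-Unique : ∀ n → Unique (outList G n)
  outList-Unique n = Unique.filter⁺ (λ e → source G e ≟F n) (Unique.allFin⁺ (edges G))

-- The step function of the fold defining sumOcc is local to Defs; unification recovers it.
sumOcc-as-foldr : ∀ {k} (G H : Graph k) n (lf : Choice G H n) f →
  Σ (Fin (edges G) → Interval → Interval) λ step →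
    foldr step zeroI (allFin (edges G)) ≡ sumOcc G H n lf f
sumOcc-as-foldr G H n lf f = _ , refl

module Matchings {k : ℕ} (G H : Graph k) where

  open Counting (_≟F_ {edges H})

  _≟M_ : DecidableEquality (Maybe (Fin (edges H)))
  _≟M_ = Maybe-≡-dec _≟F_

  EG EH NG NH : Set
  EG = Fin (edges G)
  EH = Fin (edges H)
  NG = Fin (nodes G)
  NH = Fin (nodes H)

  EdgeFits : REL NG NH 0ℓ → NH → EG → EH → Set
  EdgeFits R m e f = source H f ≡ m × lab G e ≡ lab H f × R (target G e) (target H f)

  MatchingBy : REL NG NH 0ℓ → NG → NH → (EG → Maybe EH) → Set
  MatchingBy R n m α =
    (∀ e → source G e ≡ n → ∃ λ f → α e ≡ just f × EdgeFits R m e f) ×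
    (∀ f → source H f ≡ m → multiplicity α f (outList G n) ∈I occur H f)

  Matching : REL NG NH 0ℓ → REL NG NH 0ℓ
  Matching R n m = Σ (EG → Maybe EH) (MatchingBy R n m)

  Matching-mono : ∀ {R R′} → R ⇒ R′ → Matching R ⇒ Matching R′
  Matching-mono R⇒R′ (α , matched , counted) =
    α , (λ e p → let f , αe≡ , src , lab≡ , r = matched e p in f , αe≡ , src , lab≡ , R⇒R′ r) , counted

  MatchingBy-cong : ∀ {R n m α α′} → α ≗ α′ → MatchingBy R n m α → MatchingBy R n m α′
  MatchingBy-cong {n = n} α≗α′ (matched , counted) =
    (λ e p → let f , αe≡ , fits = matched e p in f , trans (≡.sym (α≗α′ e)) αe≡ , fits) ,
    (λ f q → subst (_∈I occur H f) (multiplicity-cong f (outList G n) (λ {e} _ → α≗α′ e)) (counted f q))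

  matching? : ∀ {R} → Decidable₂ R → Decidable₂ (Matching R)
  matching? {R} R? n m = Fin→-exhaustible (Maybe-exhaustible Fin.any?) (MatchingBy-cong {R}) matchingBy?
    where
    edgeFits? : ∀ e f → Dec (EdgeFits R m e f)
    edgeFits? e f = (source H f ≟F m) ×-dec (lab G e ≟F lab H f) ×-dec R? (target G e) (target H f)
    matchingBy? : ∀ α → Dec (MatchingBy R n m α)
    matchingBy? α =
      Fin.all? (λ e → (source G e ≟F n) →-dec Fin.any? λ f → (α e ≟M just f) ×-dec edgeFits? e f) ×-dec
      Fin.all? (λ f → (source H f ≟F m) →-dec (multiplicity α f (outList G n) ∈I? occur H f))

  SimulatesAt : REL NG NH 0ℓ → REL NG NH 0ℓ
  SimulatesAt R n m = Σ (Choice G H n) λ lf →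
    (∀ e (p : source G e ≡ n) →
       (source H (lf e p) ≡ m) ×
       (lab G e ≡ lab H (lf e p)) ×
       R (target G e) (target H (lf e p))) ×
    (∀ f → source H f ≡ m → sumOcc G H n lf f ⊆I occur H f)

  module _ (occur≡1 : ∀ e → occur G e ≡ ⟦ b[1,1] ⟧) {n : NG} (lf : Choice G H n) {α : EG → Maybe EH}
           (α≡lf : ∀ e p → α e ≡ just (lf e p)) where

    sumOcc-simple : ∀ f → lo (sumOcc G H n lf f) ≡ multiplicity α f (outList G n) ×
                          up (sumOcc G H n lf f) ≡ fin (multiplicity α f (outList G n))
    sumOcc-simple f = go (allFin (edges G))
      where
      step : EG → Interval → Interval
      step = proj₁ (sumOcc-as-foldr G H n lf f)
      go : ∀ l → lo (foldr step zeroI l) ≡ multiplicity α f (filter (λ e → source G e ≟F n) l) ×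
                 up (foldr step zeroI l) ≡ fin (multiplicity α f (filter (λ e → source G e ≟F n) l))
      go []      = refl , refl
      go (e ∷ l) with source G e ≟F n | go l
      ... | no _  | lo≡ , up≡ = lo≡ , cong (fin 0 +∞_) up≡
      ... | yes p | lo≡ , up≡ rewrite α≡lf e p with lf e p ≟F f
      ...   | yes _ rewrite occur≡1 e = cong suc lo≡ , cong (fin 1 +∞_) up≡
      ...   | no _  = lo≡ , cong (fin 0 +∞_) up≡

    sumOcc⊆I⇔multiplicity∈I : ∀ f I → sumOcc G H n lf f ⊆I I ⇔ multiplicity α f (outList G n) ∈I I
    sumOcc⊆I⇔multiplicity∈I f I =
      let lo≡ , up≡ = sumOcc-simple f in point-⊆I⇔∈I {sumOcc G H n lf f} {I} lo≡ up≡

  partial : ∀ {n} → Choice G H n → EG → Maybe EH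
  partial {n} lf e with source G e ≟F n
  ... | yes p = just (lf e p)
  ... | no _  = nothing

  partial-≡ : ∀ {n} (lf : Choice G H n) e p → partial lf e ≡ just (lf e p)
  partial-≡ {n} lf e p with source G e ≟F n
  ... | yes p′ = cong (just ∘ lf e) (Decidable⇒UIP.≡-irrelevant _≟F_ p′ p)
  ... | no ¬p  = contradiction p ¬p

  simulatesAt⇒matching : ∀ {R} → (∀ e → occur G e ≡ ⟦ b[1,1] ⟧) → SimulatesAt R ⇒ Matching R
  simulatesAt⇒matching occur≡1 (lf , fits , included) =
    partial lf , (λ e p → lf e p , partial-≡ lf e p , fits e p) ,
    λ f q → Equivalence.to (sumOcc⊆I⇔multiplicity∈I occur≡1 lf (partial-≡ lf) f (occur H f)) (included f q)

  matching⇒simulatesAt : ∀ {R} → (∀ e → occur G e ≡ ⟦ b[1,1] ⟧) → Matching R ⇒ SimulatesAt R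
  matching⇒simulatesAt occur≡1 (α , matched , counted) =
    lf , (λ e p → proj₂ (proj₂ (matched e p))) ,
    λ f q → Equivalence.from (sumOcc⊆I⇔multiplicity∈I occur≡1 lf α≡lf f (occur H f)) (counted f q)
    where
    lf : Choice G H _
    lf e p = proj₁ (matched e p)
    α≡lf : ∀ e p → α e ≡ just (lf e p)
    α≡lf e p = proj₁ (proj₂ (matched e p))

shapeComponent : ∀ {k} (H : Graph k) → IsShapeGraph H → Fin (edges H) → (Fin k × Fin (nodes H)) × Basic
shapeComponent H shape f = (lab H f , target H f) , proj₁ (shape f)

shapeComponents : ∀ {k} (H : Graph k) → IsShapeGraph H →
                  Fin (nodes H) → List ((Fin k × Fin (nodes H)) × Basic)
shapeComponents H shape m = map (shapeComponent H shape) (outList H m)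

-- δ′ need only be propositionally equal to the canonical definitions, so that given RBE₀ schemas fit as well.
module ShapeGraphSchema {k : ℕ} (H : Graph k) (shape : IsShapeGraph H)
  (δ′ : Fin (nodes H) → RBE (Fin k × Fin (nodes H)))
  (δ′≡ : ∀ m → δ′ m ≡ rbe0 (shapeComponents H shape m)) where

  schema : Schema k
  schema = record { types = nodes H ; δ = δ′ }

  module _ (G : Graph k) where

    open Matchings G H
    open Counting (_≟F_ {edges H})
    open Rbe₀Membership (_≟F_ {edges G}) (_≟F_ {edges H}) (λ f → lab H f , target H f) (proj₁ ∘ shape)
      using (Rbe₀Assignment; ∈rbe0⇒assignment; assignment⇒∈rbe0)

    TypesAt : (NG → NH → Bool) → NG → NH → Set
    TypesAt T n m = Σ _ λ w → InSign G schema T n w × InL (δ′ m) w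

    typesAt⇒matching : ∀ {T n m} → TypesAt T n m → Matching (Holds T) n m
    typesAt⇒matching {T} {n} {m} (w , (c , c-typed , w↭) , w∈) = α , matched , counted
      where
      signature∈ : InL (rbe0 (shapeComponents H shape m)) (map (λ e → lab G e , c e) (outList G n))
      signature∈ = InL-resp-↭ _ w↭ (subst (λ E → InL E w) (δ′≡ m) w∈)
      assignment : ∃ λ α → Rbe₀Assignment α (λ e → lab G e , c e) (outList G n) (outList H m)
      assignment = ∈rbe0⇒assignment (outList-Unique G n) (outList-Unique H m) signature∈
      α : EG → Maybe EH
      α = proj₁ assignment
      matched : ∀ e → source G e ≡ n → ∃ λ f → α e ≡ just f × EdgeFits (Holds T) m e f
      matched e p =
        let f , αe≡ , f∈ , sf≡ = proj₁ (proj₂ assignment) (∈-outList⁺ G p)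
        in  f , αe≡ , ∈-outList⁻ H f∈ , ≡.sym (cong proj₁ sf≡) ,
            subst (Holds T (target G e)) (≡.sym (cong proj₂ sf≡)) (c-typed e p)
      counted : ∀ f → source H f ≡ m → multiplicity α f (outList G n) ∈I occur H f
      counted f q = subst (multiplicity α f (outList G n) ∈I_) (≡.sym (proj₂ (shape f)))
                          (proj₂ (proj₂ assignment) (∈-outList⁺ H q))

    matching⇒typesAt : ∀ {T n m} → Matching (Holds T) n m → TypesAt T n m
    matching⇒typesAt {T} {n} {m} (α , matched , counted) =
      map label (outList G n) , (c , c-typed , ↭-refl) ,
      subst (λ E → InL E (map label (outList G n))) (≡.sym (δ′≡ m))
            (assignment⇒∈rbe0 (outList-Unique H m) (assigned , within))
      where
      c : EG → NH
      c e = maybe′ (target H) m (α e)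
      label : EG → Fin k × NH
      label e = lab G e , c e
      c-typed : ∀ e → source G e ≡ n → T (target G e) (c e) ≡ true
      c-typed e p with f , αe≡ , _ , _ , Tef ← matched e p rewrite αe≡ = Tef
      assigned : ∀ {e} → e ∈ outList G n →
                 ∃ λ f → α e ≡ just f × f ∈ outList H m × (lab H f , target H f) ≡ label e
      assigned {e} e∈ =
        let f , αe≡ , src , lab≡ , _ = matched e (∈-outList⁻ G e∈)
        in  f , αe≡ , ∈-outList⁺ H src , cong₂ _,_ (≡.sym lab≡) (≡.sym (cong (maybe′ (target H) m) αe≡))
      within : ∀ {f} → f ∈ outList H m → multiplicity α f (outList G n) ∈I ⟦ proj₁ (shape f) ⟧
      within {f} f∈ =
        subst (multiplicity α f (outList G n) ∈I_) (proj₂ (shape f)) (counted f (∈-outList⁻ H f∈))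

    open GreatestPostFixpoint Matching Matching-mono matching?

    L-schema⇒L-graph : InLSchema schema G → InLGraph H G
    L-schema⇒L-graph (simple , T , valid , _ , typed) =
      simple , Holds T ,
      (λ n m Tnm → matching⇒simulatesAt {Holds T} (proj₁ simple) (typesAt⇒matching {T} (valid n m Tnm))) ,
      typed

    L-graph⇒L-schema : InLGraph H G → InLSchema schema G
    L-graph⇒L-schema (simple , R , simulation , total) = simple , ν , valid , maximal , typed
      where
      valid : IsValid G schema ν
      valid n m νnm = matching⇒typesAt {ν} (ν-post νnm)
      maximal : ∀ T → IsValid G schema T → ∀ n m → T n m ≡ true → ν n m ≡ true
      maximal T valid-T n m = ν-greatest (λ {n} {m} Tnm → typesAt⇒matching {T} (valid-T n m Tnm))
      typed : ∀ n → Σ NH λ m → ν n m ≡ true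
      typed n = let m , Rnm = total n in
        m , ν-greatest (λ {n} {m} Rnm → simulatesAt⇒matching {R} (proj₁ simple) (simulation n m Rnm)) Rnm

    L-schema⇔L-graph : InLSchema schema G ⇔ InLGraph H G
    L-schema⇔L-graph = mk⇔ L-schema⇒L-graph L-graph⇒L-schema

module _ {K V : Set} (_≟_ : DecidableEquality K) where

  tagged : (K → List V) → List K → List (K × V)
  tagged vs = concatMap (λ t → map (t ,_) (vs t))

  HasKey? : (t : K) (p : K × V) → Dec (proj₁ p ≡ t)
  HasKey? t p = proj₁ p ≟ t

  filter-tag-≢ : ∀ {t t′} → t′ ≢ t → ∀ vs → filter (HasKey? t) (map (t′ ,_) vs) ≡ []
  filter-tag-≢ t′≢t vs = filter-none (HasKey? _) (AllP.map⁺ (All.universal (λ _ → t′≢t) vs))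

  filter-tagged-∉ : ∀ vs {t} ts → All.All (_≢ t) ts → filter (HasKey? t) (tagged vs ts) ≡ []
  filter-tagged-∉ vs ts ts≢t =
    filter-none (HasKey? _)
      (AllP.concat⁺ (AllP.map⁺ (All.map (λ t′≢t → AllP.map⁺ (All.universal (λ _ → t′≢t) _)) ts≢t)))

  filter-tagged : ∀ vs {t} ts → Unique ts → t ∈ ts → map proj₂ (filter (HasKey? t) (tagged vs ts)) ≡ vs t
  filter-tagged vs {t} (t ∷ ts) (t∉ts ∷ _) (here refl) = begin
    map proj₂ (filter (HasKey? t) (map (t ,_) (vs t) ++ tagged vs ts))
      ≡⟨ cong (map proj₂) (filter-++ (HasKey? t) (map (t ,_) (vs t)) (tagged vs ts)) ⟩
    map proj₂ (filter (HasKey? t) (map (t ,_) (vs t)) ++ filter (HasKey? t) (tagged vs ts))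
      ≡⟨ cong₂ (λ xs ys → map proj₂ (xs ++ ys))
               (filter-all (HasKey? t) (AllP.map⁺ (All.universal (λ _ → refl) (vs t))))
               (filter-tagged-∉ vs ts (All.map ≢-sym t∉ts)) ⟩
    map proj₂ (map (t ,_) (vs t) ++ [])
      ≡⟨ cong (map proj₂) (++-identityʳ _) ⟩
    map proj₂ (map (t ,_) (vs t))
      ≡⟨ ≡.sym (map-∘ (vs t)) ⟩
    map (λ v → v) (vs t)
      ≡⟨ map-id (vs t) ⟩
    vs t ∎
  filter-tagged vs {t} (t′ ∷ ts) (t′∉ts ∷ u) (there t∈ts) = begin
    map proj₂ (filter (HasKey? t) (map (t′ ,_) (vs t′) ++ tagged vs ts))
      ≡⟨ cong (map proj₂) (filter-++ (HasKey? t) (map (t′ ,_) (vs t′)) (tagged vs ts)) ⟩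
    map proj₂ (filter (HasKey? t) (map (t′ ,_) (vs t′)) ++ filter (HasKey? t) (tagged vs ts))
      ≡⟨ cong (λ xs → map proj₂ (xs ++ _)) (filter-tag-≢ (λ t′≡t → All.lookup t′∉ts t∈ts t′≡t) (vs t′)) ⟩
    map proj₂ (filter (HasKey? t) (tagged vs ts))
      ≡⟨ filter-tagged vs ts u t∈ts ⟩
    vs t ∎

map-filter-∘ : ∀ {A B C : Set} {P : Pred B 0ℓ} (P? : Decidable₁ P) (h : A → B) (g : B → C) xs →
               map (g ∘ h) (filter (P? ∘ h) xs) ≡ map g (filter P? (map h xs))
map-filter-∘ P? h g []       = refl
map-filter-∘ P? h g (x ∷ xs) with does (P? (h x))
... | true  = cong (g (h x) ∷_) (map-filter-∘ P? h g xs)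
... | false = map-filter-∘ P? h g xs

module SchemaShapeGraph {k : ℕ} (S : Schema k) (rbe0-δ : AllRBE0 S) where

  components : Fin (types S) → List ((Fin k × Fin (types S)) × Basic)
  components t = proj₁ (rbe0-δ t)

  edgeList : List (Fin (types S) × ((Fin k × Fin (types S)) × Basic))
  edgeList = tagged _≟F_ components (allFin (types S))

  graph : Graph k
  graph = record
    { nodes  = types S
    ; edges  = length edgeList
    ; source = proj₁ ∘ lookup edgeList
    ; target = proj₂ ∘ proj₁ ∘ proj₂ ∘ lookup edgeList
    ; lab    = proj₁ ∘ proj₁ ∘ proj₂ ∘ lookup edgeList
    ; occur  = ⟦_⟧ ∘ proj₂ ∘ proj₂ ∘ lookup edgeList
    }

  graph-shape : IsShapeGraph graph
  graph-shape f = proj₂ (proj₂ (lookup edgeList f)) , refl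

  shapeComponents-graph : ∀ t → shapeComponents graph graph-shape t ≡ components t
  shapeComponents-graph t = begin
    map (proj₂ ∘ lookup edgeList) (filter (HasKey? _≟F_ t ∘ lookup edgeList) (allFin (length edgeList)))
      ≡⟨ map-filter-∘ (HasKey? _≟F_ t) (lookup edgeList) proj₂ (allFin (length edgeList)) ⟩
    map proj₂ (filter (HasKey? _≟F_ t) (map (lookup edgeList) (allFin (length edgeList))))
      ≡⟨ cong (map proj₂ ∘ filter (HasKey? _≟F_ t))
              (trans (map-tabulate (λ i → i) (lookup edgeList)) (tabulate-lookup edgeList)) ⟩
    map proj₂ (filter (HasKey? _≟F_ t) edgeList)
      ≡⟨ filter-tagged _≟F_ components _ (Unique.allFin⁺ (types S)) (∈-allFin t) ⟩
    components t ∎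

  δ≡shapeComponents : ∀ t → δ S t ≡ rbe0 (shapeComponents graph graph-shape t)
  δ≡shapeComponents t = trans (proj₂ (rbe0-δ t)) (cong rbe0 (≡.sym (shapeComponents-graph t)))

proposition1 : (k : ℕ) →
    ((H : Graph k) → IsShapeGraph H →
      Σ (Schema k) λ S → AllRBE0 S × ((G : Graph k) → InLSchema S G ⇔ InLGraph H G))
    ×
    ((S : Schema k) → AllRBE0 S →
      Σ (Graph k) λ H → IsShapeGraph H × ((G : Graph k) → InLGraph H G ⇔ InLSchema S G))
proposition1 k = shapeGraph⇒schema , schema⇒shapeGraph
  where
  shapeGraph⇒schema : (H : Graph k) → IsShapeGraph H →
    Σ (Schema k) λ S → AllRBE0 S × ((G : Graph k) → InLSchema S G ⇔ InLGraph H G)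
  shapeGraph⇒schema H shape =
    schema , (λ m → shapeComponents H shape m , refl) , L-schema⇔L-graph
    where open ShapeGraphSchema H shape (rbe0 ∘ shapeComponents H shape) (λ _ → refl)
  schema⇒shapeGraph : (S : Schema k) → AllRBE0 S →
    Σ (Graph k) λ H → IsShapeGraph H × ((G : Graph k) → InLGraph H G ⇔ InLSchema S G)
  schema⇒shapeGraph S rbe0-δ =
    graph , graph-shape , λ G → ⇔-sym (L-schema⇔L-graph G)
    where
    open SchemaShapeGraph S rbe0-δ
    open ShapeGraphSchema graph graph-shape (δ S) δ≡shapeComponents
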